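{- For every fixed positive integer $k$, there exist $k$-unbalanced digraphs of arbitrarily large chromatic number.
   Context: A digraph is a pair $\mathcal{G}=(V,E)$ with $E\subseteq V^2$ and no edge of the form $(v,v)$; its chromatic number is the least $\chi$ (possibly infinite) such that some map $c:V\to[\chi]$ has $c(a)\ne c(b)$ for all $(a,b)\in E$. A cycle of $\mathcal{G}$ is a closed walk $c=(v_0,e_1,v_1,\dots,e_n,v_n)$ with $v_n=v_0$, $e_i\in E$ and $\{v_{i-1},v_i\}$ the endpoints of $e_i$; step $i$ is a forward edge if $e_i=(v_{i-1},v_i)$ and a backward edge otherwise. $\mathcal{G}$ is $k$-unbalanced if for every cycle $c$ of $\mathcal{G}$, either $c$ has exactly as many forward edges as backward edges, or there are two non-overlapping contiguous stretches of $c$ (each consisting of consecutive steps of $c$) such that one stretch has at least $k$ more forward edges than backward edges and the other has at least $k$ fewer forward edges than backward edges. -}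

module Defs where

open import Data.Nat using (ℕ)
open import Data.Integer using (ℤ; +_; -_; _+_; _≤_; 0ℤ; 1ℤ)
open import Data.Bool using (Bool; true; false)
open import Data.List using (List; []; _∷_; _++_)
open import Data.Fin using (Fin)
open import Data.Product using (Σ; _×_; ∃-syntax)
open import Data.Sum using (_⊎_)
open import Relation.Nullary using (¬_)
open import Relation.Binary.PropositionalEquality using (_≡_; _≢_)

record Digraph : Set₁ where
  field
    V      : Set
    E      : V → V → Set
    irrefl : ∀ v → ¬ E v v

open Digraph public

data Walk (G : Digraph) : V G → V G → Set where
  nil : ∀ {v} → Walk G v v
  fwd : ∀ {u w v} → E G u w → Walk G w v → Walk G u v
  bwd : ∀ {u w v} → E G w u → Walk G w v → Walk G u v

Cycle : Digraph → Set
Cycle G = Σ (V G) λ v → Walk G v v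

dirs : ∀ {G u v} → Walk G u v → List Bool
dirs nil       = []
dirs (fwd _ w) = true ∷ dirs w
dirs (bwd _ w) = false ∷ dirs w

excess : List Bool → ℤ
excess []           = 0ℤ
excess (true ∷ xs)  = 1ℤ + excess xs
excess (false ∷ xs) = - 1ℤ + excess xs

TwoStretches : ℕ → List Bool → Set
TwoStretches k ds =
  ∃[ p ] ∃[ s₁ ] ∃[ m ] ∃[ s₂ ] ∃[ q ]
    (ds ≡ p ++ s₁ ++ m ++ s₂ ++ q) ×
    (((+ k ≤ excess s₁) × (excess s₂ ≤ - (+ k)))
     ⊎ ((excess s₁ ≤ - (+ k)) × (+ k ≤ excess s₂)))

Unbalanced : ℕ → Digraph → Set
Unbalanced k G = (c : Cycle G) →
  let ds = dirs (Data.Product.proj₂ c) in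
  (excess ds ≡ 0ℤ) ⊎ TwoStretches k ds

Colourable : Digraph → ℕ → Set
Colourable G m = Σ (V G → Fin m) λ c → ∀ a b → E G a b → c a ≢ c b

-- Witnesses are shift graphs: vertices are increasing tuples (t₀, …, t_s) of naturals, with an
-- edge (t₀, …, t_s) → (t₁, …, t_s, y) whenever y > t_s.  Their chromatic number is unbounded
-- (Erdős–Hajnal): a proper m-colouring for tuple length s + 2 induces a proper 2^m-colouring for
-- length s + 1, sending a tuple to the set of colours of its one-step extensions.
--
-- For s = 4k they are k-unbalanced.  Along a walk, follow one entry of the current tuple: a
-- forward step moves it one coordinate down, a backward step one coordinate up, and when it
-- would leave coordinate 0 we follow the new coordinate 0 instead, whose value is strictly
-- larger.  If a closed walk has positive excess and no stretch of excess below −2k, the entry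
-- can be started at a coordinate from which it stays inside the tuple, switches at least once
-- and ends where it started — so the value at that coordinate would exceed itself.  Hence some
-- stretch has excess below −2k, and then the part before it or the part after it has excess
-- at least k.  Cycles of negative excess are reversed.

module Submission where

open import Defs
open import Data.Bool using (Bool; true; false; not)
open import Data.Bool.Properties using (not-involutive)
open import Data.Empty using (⊥-elim)
open import Data.Fin as Fin using (Fin; toℕ; funToFin; finToFun)
import Data.Fin.Properties as Fin
open import Data.Integer as ℤ using (ℤ; +_; -_; 0ℤ; 1ℤ)
import Data.Integer.Properties as ℤ
open import Data.Integer.Tactic.RingSolver using (solve-∀)
open import Algebra.Properties.CommutativeSemigroup ℤ.+-commutativeSemigroup using (x∙yz≈y∙xz)
open import Data.List using (List; []; _∷_; _++_; map; reverse; _ʳ++_)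
import Data.List.Properties as List
open import Data.Nat using (ℕ; zero; suc; _+_; _^_; _≤_; _<_; z≤n; s≤s)
import Data.Nat.Properties as ℕ
open import Data.Product using (Σ; _,_; _×_; ∃-syntax; proj₁)
open import Data.Sum using (_⊎_; inj₁; inj₂)
open import Function using (_∘_; id)
open import Relation.Binary using (tri<; tri≈; tri>)
open import Relation.Binary.PropositionalEquality
open import Relation.Nullary using (¬_; Dec; yes; no)

step : Bool → ℤ
step true  = 1ℤ
step false = - 1ℤ

excess-∷ : ∀ b xs → excess (b ∷ xs) ≡ step b ℤ.+ excess xs
excess-∷ true  xs = refl
excess-∷ false xs = refl

excess-++ : ∀ xs ys → excess (xs ++ ys) ≡ excess xs ℤ.+ excess ys
excess-++ []       ys = sym (ℤ.+-identityˡ (excess ys))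
excess-++ (b ∷ xs) ys = begin
  excess (b ∷ xs ++ ys)               ≡⟨ excess-∷ b (xs ++ ys) ⟩
  step b ℤ.+ excess (xs ++ ys)        ≡⟨ cong (ℤ._+_ (step b)) (excess-++ xs ys) ⟩
  step b ℤ.+ (excess xs ℤ.+ excess ys) ≡⟨ ℤ.+-assoc (step b) _ _ ⟨
  (step b ℤ.+ excess xs) ℤ.+ excess ys ≡⟨ cong (ℤ._+ excess ys) (excess-∷ b xs) ⟨
  excess (b ∷ xs) ℤ.+ excess ys       ∎
  where open ≡-Reasoning

excess-++-++ : ∀ xs ys zs → excess (xs ++ ys ++ zs) ≡ excess xs ℤ.+ (excess ys ℤ.+ excess zs)
excess-++-++ xs ys zs = trans (excess-++ xs (ys ++ zs)) (cong (ℤ._+_ (excess xs)) (excess-++ ys zs))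

excess-ʳ++ : ∀ xs ys → excess (xs ʳ++ ys) ≡ excess xs ℤ.+ excess ys
excess-ʳ++ []       ys = sym (ℤ.+-identityˡ (excess ys))
excess-ʳ++ (b ∷ xs) ys = begin
  excess (xs ʳ++ b ∷ ys)               ≡⟨ excess-ʳ++ xs (b ∷ ys) ⟩
  excess xs ℤ.+ excess (b ∷ ys)        ≡⟨ cong (ℤ._+_ (excess xs)) (excess-∷ b ys) ⟩
  excess xs ℤ.+ (step b ℤ.+ excess ys) ≡⟨ x∙yz≈y∙xz (excess xs) (step b) (excess ys) ⟩
  step b ℤ.+ (excess xs ℤ.+ excess ys) ≡⟨ ℤ.+-assoc (step b) _ _ ⟨
  (step b ℤ.+ excess xs) ℤ.+ excess ys ≡⟨ cong (ℤ._+ excess ys) (excess-∷ b xs) ⟨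
  excess (b ∷ xs) ℤ.+ excess ys        ∎
  where open ≡-Reasoning

excess-map-not : ∀ xs → excess (map not xs) ≡ - excess xs
excess-map-not []       = refl
excess-map-not (b ∷ xs) = begin
  excess (not b ∷ map not xs)          ≡⟨ excess-∷ (not b) (map not xs) ⟩
  step (not b) ℤ.+ excess (map not xs) ≡⟨ cong₂ ℤ._+_ (step-not b) (excess-map-not xs) ⟩
  - step b ℤ.+ - excess xs             ≡⟨ ℤ.neg-distrib-+ (step b) (excess xs) ⟨
  - (step b ℤ.+ excess xs)             ≡⟨ cong -_ (excess-∷ b xs) ⟨
  - excess (b ∷ xs)                    ∎
  where
  open ≡-Reasoning
  step-not : ∀ b → step (not b) ≡ - step b
  step-not true  = refl
  step-not false = refl

mirror : List Bool → List Bool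
mirror ds = reverse (map not ds)

excess-mirror : ∀ xs → excess (mirror xs) ≡ - excess xs
excess-mirror xs = begin
  excess (mirror xs)                ≡⟨ excess-ʳ++ (map not xs) [] ⟩
  excess (map not xs) ℤ.+ 0ℤ        ≡⟨ ℤ.+-identityʳ _ ⟩
  excess (map not xs)               ≡⟨ excess-map-not xs ⟩
  - excess xs                       ∎
  where open ≡-Reasoning

mirror-++ : ∀ xs ys → mirror (xs ++ ys) ≡ mirror ys ++ mirror xs
mirror-++ xs ys =
  trans (cong reverse (List.map-++ not xs ys)) (List.reverse-++ (map not xs) (map not ys))

mirror-involutive : ∀ xs → mirror (mirror xs) ≡ xs
mirror-involutive xs = begin
  reverse (map not (reverse (map not xs))) ≡⟨ cong reverse (List.reverse-map not (map not xs)) ⟩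
  reverse (reverse (map not (map not xs))) ≡⟨ List.reverse-involutive _ ⟩
  map not (map not xs)                     ≡⟨ List.map-∘ xs ⟨
  map (not ∘ not) xs                       ≡⟨ List.map-cong not-involutive xs ⟩
  map id xs                                ≡⟨ List.map-id xs ⟩
  xs                                       ∎
  where open ≡-Reasoning

mirror-++-++ : ∀ xs ys zs → mirror (xs ++ ys ++ zs) ≡ mirror zs ++ mirror ys ++ mirror xs
mirror-++-++ xs ys zs = begin
  mirror (xs ++ ys ++ zs)                ≡⟨ mirror-++ xs (ys ++ zs) ⟩
  mirror (ys ++ zs) ++ mirror xs         ≡⟨ cong (_++ mirror xs) (mirror-++ ys zs) ⟩
  (mirror zs ++ mirror ys) ++ mirror xs  ≡⟨ List.++-assoc (mirror zs) _ _ ⟩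
  mirror zs ++ mirror ys ++ mirror xs    ∎
  where open ≡-Reasoning

TwoStretches-mirror : ∀ {k ds} → TwoStretches k (mirror ds) → TwoStretches k ds
TwoStretches-mirror {k} {ds} (p , s₁ , m , s₂ , q , eq , stretches) =
  mirror q , mirror s₂ , mirror m , mirror s₁ , mirror p , ds≡ , swap stretches
  where
  ds≡ : ds ≡ mirror q ++ mirror s₂ ++ mirror m ++ mirror s₁ ++ mirror p
  ds≡ = begin
    ds                                                       ≡⟨ mirror-involutive ds ⟨
    mirror (mirror ds)                                       ≡⟨ cong mirror eq ⟩
    mirror (p ++ s₁ ++ (m ++ s₂ ++ q))                       ≡⟨ mirror-++-++ p s₁ _ ⟩
    mirror (m ++ s₂ ++ q) ++ mirror s₁ ++ mirror p
      ≡⟨ cong (_++ _) (mirror-++-++ m s₂ q) ⟩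
    (mirror q ++ mirror s₂ ++ mirror m) ++ mirror s₁ ++ mirror p
      ≡⟨ List.++-assoc (mirror q) _ _ ⟩
    mirror q ++ (mirror s₂ ++ mirror m) ++ mirror s₁ ++ mirror p
      ≡⟨ cong (mirror q ++_) (List.++-assoc (mirror s₂) _ _) ⟩
    mirror q ++ mirror s₂ ++ mirror m ++ mirror s₁ ++ mirror p ∎
    where open ≡-Reasoning
  up : ∀ xs → + k ℤ.≤ excess xs → excess (mirror xs) ℤ.≤ - (+ k)
  up xs k≤ = ℤ.≤-trans (ℤ.≤-reflexive (excess-mirror xs)) (ℤ.neg-mono-≤ k≤)
  down : ∀ xs → excess xs ℤ.≤ - (+ k) → + k ℤ.≤ excess (mirror xs)
  down xs ≤-k = begin
    + k                 ≡⟨ ℤ.neg-involutive (+ k) ⟨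
    - - (+ k)           ≤⟨ ℤ.neg-mono-≤ ≤-k ⟩
    - excess xs         ≡⟨ excess-mirror xs ⟨
    excess (mirror xs)  ∎
    where open ℤ.≤-Reasoning
  Signs : List Bool → List Bool → Set
  Signs xs ys = ((+ k ℤ.≤ excess xs) × (excess ys ℤ.≤ - (+ k)))
              ⊎ ((excess xs ℤ.≤ - (+ k)) × (+ k ℤ.≤ excess ys))
  swap : Signs s₁ s₂ → Signs (mirror s₂) (mirror s₁)
  swap (inj₁ (k≤s₁ , s₂≤-k)) = inj₁ (down s₂ s₂≤-k , up s₁ k≤s₁)
  swap (inj₂ (s₁≤-k , k≤s₂)) = inj₂ (up s₂ k≤s₂ , down s₁ s₁≤-k)

reverseOnto : ∀ {G u v w} → Walk G u v → Walk G u w → Walk G v w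
reverseOnto nil       acc = acc
reverseOnto (fwd e w) acc = reverseOnto w (bwd e acc)
reverseOnto (bwd e w) acc = reverseOnto w (fwd e acc)

reverseWalk : ∀ {G u v} → Walk G u v → Walk G v u
reverseWalk w = reverseOnto w nil

dirs-reverseOnto : ∀ {G u v w} (c : Walk G u v) (acc : Walk G u w) →
                   dirs (reverseOnto c acc) ≡ map not (dirs c) ʳ++ dirs acc
dirs-reverseOnto nil       acc = refl
dirs-reverseOnto (fwd e c) acc = dirs-reverseOnto c (bwd e acc)
dirs-reverseOnto (bwd e c) acc = dirs-reverseOnto c (fwd e acc)

dirs-reverseWalk : ∀ {G u v} (w : Walk G u v) → dirs (reverseWalk w) ≡ mirror (dirs w)
dirs-reverseWalk w = dirs-reverseOnto w nil

DropsAtMost : ℕ → List Bool → Set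
DropsAtMost B ds = ∀ p x q → ds ≡ p ++ x ++ q → - (+ B) ℤ.≤ excess x

DropsAtMost-∷ : ∀ {B b ds} → DropsAtMost B (b ∷ ds) → DropsAtMost B ds
DropsAtMost-∷ {b = b} drops p x q eq = drops (b ∷ p) x q (cong (b ∷_) eq)

DropsAtMost-prefix : ∀ {B ds} → DropsAtMost B ds → ∀ p q → ds ≡ p ++ q → DropsAtMost B p
DropsAtMost-prefix drops _ q refl p x r refl =
  drops p x (r ++ q) (trans (List.++-assoc p (x ++ r) q) (cong (p ++_) (List.++-assoc x r q)))

DropsAtMost-mono : ∀ {B C ds} → B ≤ C → DropsAtMost B ds → DropsAtMost C ds
DropsAtMost-mono B≤C drops p x q eq =
  ℤ.≤-trans (ℤ.neg-mono-≤ (ℤ.+≤+ B≤C)) (drops p x q eq)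

DropsAtMost⇒0≤B+excess : ∀ {B ds} → DropsAtMost B ds → 0ℤ ℤ.≤ + B ℤ.+ excess ds
DropsAtMost⇒0≤B+excess {B} {ds} drops =
  subst (ℤ._≤ + B ℤ.+ excess ds) (ℤ.+-inverseʳ (+ B))
    (ℤ.+-monoʳ-≤ (+ B) (drops [] ds [] (sym (List.++-identityʳ ds))))

-- track d ds is the coordinate of the followed entry after the steps ds, starting from
-- coordinate d; gain d ds counts the switches at coordinate 0.
track : ℕ → List Bool → ℕ
track d       []           = d
track d       (false ∷ ds) = track (suc d) ds
track zero    (true ∷ ds)  = track zero ds
track (suc d) (true ∷ ds)  = track d ds

gain : ℕ → List Bool → ℕ
gain d       []           = 0
gain d       (false ∷ ds) = gain (suc d) ds
gain zero    (true ∷ ds)  = suc (gain zero ds)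
gain (suc d) (true ∷ ds)  = gain d ds

track-excess : ∀ d ds → + track d ds ℤ.+ excess ds ≡ + d ℤ.+ + gain d ds
track-excess d       []           = refl
track-excess d       (false ∷ ds) =
  trans (x∙yz≈y∙xz (+ track (suc d) ds) (- 1ℤ) (excess ds))
        (cong (ℤ._+_ (- 1ℤ)) (track-excess (suc d) ds))
track-excess zero    (true ∷ ds)  =
  trans (x∙yz≈y∙xz (+ track zero ds) 1ℤ (excess ds)) (cong (ℤ._+_ 1ℤ) (track-excess zero ds))
track-excess (suc d) (true ∷ ds)  =
  trans (x∙yz≈y∙xz (+ track d ds) 1ℤ (excess ds)) (cong (ℤ._+_ 1ℤ) (track-excess d ds))

gain-shift : ∀ a d ds → gain a ds ≤ d + gain (a + d) ds
gain-shift a       d       []           = z≤n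
gain-shift a       d       (false ∷ ds) = gain-shift (suc a) d ds
gain-shift (suc a) d       (true ∷ ds)  = gain-shift a d ds
gain-shift zero    zero    (true ∷ ds)  = ℕ.≤-refl
gain-shift zero    (suc d) (true ∷ ds)  = s≤s (gain-shift zero d ds)

track-shift : ∀ a d ds → 1 ≤ gain (a + d) ds → track a ds ≡ track (a + d) ds
track-shift a       d       []           ()
track-shift a       d       (false ∷ ds) g = track-shift (suc a) d ds g
track-shift (suc a) d       (true ∷ ds)  g = track-shift a d ds g
track-shift zero    zero    (true ∷ ds)  g = refl
track-shift zero    (suc d) (true ∷ ds)  g = track-shift zero d ds g

track-≤ : ∀ {B} d ds → + d ℤ.≤ + B ℤ.+ excess ds → DropsAtMost B ds → track d ds ≤ B
track-≤ {B} d [] d≤ drops = ℤ.drop‿+≤+ (subst (+ d ℤ.≤_) (ℤ.+-identityʳ (+ B)) d≤)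
track-≤ {B} d (b ∷ ds) d≤ drops = step-case d b (subst (+ d ℤ.≤_) rearrange d≤)
  where
  rearrange : + B ℤ.+ excess (b ∷ ds) ≡ step b ℤ.+ (+ B ℤ.+ excess ds)
  rearrange = trans (cong (ℤ._+_ (+ B)) (excess-∷ b ds)) (x∙yz≈y∙xz (+ B) (step b) (excess ds))
  drops′ : DropsAtMost B ds
  drops′ = DropsAtMost-∷ drops
  step-case : ∀ d b → + d ℤ.≤ step b ℤ.+ (+ B ℤ.+ excess ds) → track d (b ∷ ds) ≤ B
  step-case d       false d≤ =
    track-≤ (suc d) ds (ℤ.i<j⇒suc[i]≤j (ℤ.i≤pred[j]⇒i<j d≤)) drops′
  step-case (suc d) true  d≤ =
    track-≤ d ds (subst (+ d ℤ.≤_) (ℤ.pred-suc _) (ℤ.i<j⇒i≤pred[j] (ℤ.suc[i]≤j⇒i<j d≤)))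
      drops′
  step-case zero    true  _  = track-≤ zero ds (DropsAtMost⇒0≤B+excess drops′) drops′

TrackedWithin : ℕ → ℕ → List Bool → Set
TrackedWithin s d ds = ∀ p q → ds ≡ p ++ q → track d p ≤ s

module _ {B ds} (positive : 0ℤ ℤ.< excess ds) (drops : DropsAtMost B ds) where

  track-start-≤ : track 0 ds ≤ B
  track-start-≤ = track-≤ 0 ds (DropsAtMost⇒0≤B+excess drops) drops

  gain-start : 1 ≤ gain (track 0 ds) ds
  gain-start = ℕ.+-cancelˡ-≤ d 1 _ (ℕ.≤-trans d+1≤gain (gain-shift 0 d ds))
    where
    d : ℕ
    d = track 0 ds
    d+1≤gain : d + 1 ≤ gain 0 ds
    d+1≤gain = ℤ.drop‿+≤+ (subst (+ (d + 1) ℤ.≤_) (track-excess 0 ds)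
                 (ℤ.+-monoʳ-≤ (+ d) (ℤ.i<j⇒suc[i]≤j positive)))

  track-start-returns : track (track 0 ds) ds ≡ track 0 ds
  track-start-returns = sym (track-shift 0 (track 0 ds) ds gain-start)

  track-start-within : TrackedWithin (B + B) (track 0 ds) ds
  track-start-within p q eq = track-≤ d p d≤ (DropsAtMost-mono (ℕ.m≤m+n B B) drops-p)
    where
    drops-p : DropsAtMost B p
    drops-p = DropsAtMost-prefix drops p q eq
    d : ℕ
    d = track 0 ds
    d≤ : + d ℤ.≤ + (B + B) ℤ.+ excess p
    d≤ = subst₂ ℤ._≤_ (ℤ.+-identityʳ (+ d)) (sym (ℤ.+-assoc (+ B) (+ B) (excess p)))
           (ℤ.+-mono-≤ (ℤ.+≤+ track-start-≤) (DropsAtMost⇒0≤B+excess drops-p))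

-- Only the values at 0, …, s matter; the rest of the function is ignored.
record Tuple (s : ℕ) : Set where
  field
    at         : ℕ → ℕ
    increasing : ∀ {i} → i < s → at i < at (suc i)

open Tuple

record Shift (s : ℕ) (a b : Tuple s) : Set where
  field
    shifted : ∀ {i} → i < s → at b i ≡ at a (suc i)
    grows   : at a s < at b s

open Shift

ShiftGraph : ℕ → Digraph
ShiftGraph s = record
  { V      = Tuple s
  ; E      = Shift s
  ; irrefl = λ a e → ℕ.<-irrefl refl (grows e)
  }

Shift-head : ∀ {s a b} → Shift s a b → at a 0 < at b 0
Shift-head {zero}  e = grows e
Shift-head {suc s} {a} e = subst (at a 0 <_) (sym (shifted e (s≤s z≤n))) (increasing a (s≤s z≤n))

climb : ∀ {s u v} (w : Walk (ShiftGraph s) u v) d → TrackedWithin s d (dirs w) →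
        at u d + gain d (dirs w) ≤ at v (track d (dirs w))
climb nil d _ = ℕ.≤-reflexive (ℕ.+-identityʳ _)
climb {u = u} {v} (fwd {w = u′} e w) zero within = begin
  at u 0 + suc (gain 0 (dirs w))  ≡⟨ ℕ.+-suc (at u 0) _ ⟩
  suc (at u 0) + gain 0 (dirs w)  ≤⟨ ℕ.+-monoˡ-≤ _ (Shift-head e) ⟩
  at u′ 0 + gain 0 (dirs w)
    ≤⟨ climb w 0 (λ p q eq → within (true ∷ p) q (cong (true ∷_) eq)) ⟩
  at v (track 0 (dirs w))         ∎
  where open ℕ.≤-Reasoning
climb (fwd e w) (suc d) within =
  subst (λ x → x + gain d (dirs w) ≤ _) (shifted e (within [] _ refl))
    (climb w d (λ p q eq → within (true ∷ p) q (cong (true ∷_) eq)))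
climb (bwd e w) d within =
  subst (λ x → x + gain (suc d) (dirs w) ≤ _) (sym (shifted e (within (false ∷ []) _ refl)))
    (climb w (suc d) (λ p q eq → within (false ∷ p) q (cong (false ∷_) eq)))

positive-cycle-drops : ∀ B {v} (w : Walk (ShiftGraph (B + B)) v v) →
                       0ℤ ℤ.< excess (dirs w) → ¬ DropsAtMost B (dirs w)
positive-cycle-drops B {v} w positive drops = ℕ.<⇒≱ (ℕ.m<m+n (at v d) gains) climbs
  where
  d : ℕ
  d = track 0 (dirs w)
  gains : 1 ≤ gain d (dirs w)
  gains = gain-start positive drops
  climbs : at v d + gain d (dirs w) ≤ at v d
  climbs = subst (λ i → at v d + gain d (dirs w) ≤ at v i) (track-start-returns positive drops)
             (climb w d (track-start-within positive drops))

PrefixWith : (List Bool → Set) → List Bool → Set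
PrefixWith P ds = ∃[ x ] ∃[ q ] ds ≡ x ++ q × P x

InfixWith : (List Bool → Set) → List Bool → Set
InfixWith P ds = ∃[ p ] ∃[ x ] ∃[ q ] ds ≡ p ++ x ++ q × P x

prefixWith? : ∀ {P} → (∀ x → Dec (P x)) → ∀ ds → Dec (PrefixWith P ds)
prefixWith? P? ds with P? []
... | yes p[] = yes ([] , ds , refl , p[])
prefixWith? P? []       | no ¬p[] = no λ { ([] , _ , _ , p[]) → ¬p[] p[] ; (_ ∷ _ , _ , () , _) }
prefixWith? P? (b ∷ ds) | no ¬p[] with prefixWith? (λ x → P? (b ∷ x)) ds
... | yes (x , q , eq , px) = yes (b ∷ x , q , cong (b ∷_) eq , px)
... | no ¬px = no λ { ([] , _ , _ , p[])          → ¬p[] p[]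
                   ; (_ ∷ x , q , refl , px) → ¬px (x , q , refl , px) }

infixWith? : ∀ {P} → (∀ x → Dec (P x)) → ∀ ds → Dec (InfixWith P ds)
infixWith? P? ds with prefixWith? P? ds
... | yes (x , q , eq , px) = yes ([] , x , q , eq , px)
infixWith? P? []       | no ¬pre = no λ { ([] , x , q , eq , px) → ¬pre (x , q , eq , px)
                                         ; (_ ∷ _ , _ , _ , () , _) }
infixWith? P? (b ∷ ds) | no ¬pre with infixWith? P? ds
... | yes (p , x , q , eq , px) = yes (b ∷ p , x , q , cong (b ∷_) eq , px)
... | no ¬inf = no λ { ([] , x , q , eq , px)       → ¬pre (x , q , eq , px)
                    ; (_ ∷ p , x , q , refl , px) → ¬inf (p , x , q , refl , px) }

excess-rest : ∀ k (P X Q : ℤ) → 0ℤ ℤ.< P ℤ.+ (X ℤ.+ Q) →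
              P ℤ.< + k → X ℤ.< - (+ k ℤ.+ + k) → + k ℤ.≤ Q
excess-rest k P X Q positive P<k X< = ℤ.<⇒≤ (begin-strict
  + k                                    ≡⟨ neg-k-2k (+ k) ⟨
  - (+ k ℤ.+ - (+ k ℤ.+ + k))            <⟨ ℤ.neg-mono-< (ℤ.+-mono-< P<k X<) ⟩
  - (P ℤ.+ X)                            ≡⟨ ℤ.+-identityˡ _ ⟨
  0ℤ ℤ.+ - (P ℤ.+ X)                     ≤⟨ ℤ.+-monoˡ-≤ _ (ℤ.<⇒≤ positive) ⟩
  P ℤ.+ (X ℤ.+ Q) ℤ.+ - (P ℤ.+ X)        ≡⟨ cancel P X Q ⟩
  Q                                      ∎)
  where
  open ℤ.≤-Reasoning
  neg-k-2k : ∀ K → - (K ℤ.+ - (K ℤ.+ K)) ≡ K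
  neg-k-2k = solve-∀
  cancel : ∀ P X Q → P ℤ.+ (X ℤ.+ Q) ℤ.+ - (P ℤ.+ X) ≡ Q
  cancel = solve-∀

below-double : ∀ {k e} → e ℤ.< - (+ (k + k)) → e ℤ.≤ - (+ k)
below-double {k} x< = ℤ.≤-trans (ℤ.<⇒≤ x<) (ℤ.neg-mono-≤ (ℤ.+≤+ (ℕ.m≤m+n k k)))

split-at-drop : ∀ k ds → 0ℤ ℤ.< excess ds → ¬ DropsAtMost (k + k) ds → TwoStretches k ds
split-at-drop k ds positive ¬drops with infixWith? (λ x → excess x ℤ.<? - (+ (k + k))) ds
... | no none = ⊥-elim (¬drops (λ p x q eq → ℤ.≮⇒≥ (λ x< → none (p , x , q , eq , x<))))
... | yes (p , x , q , eq , x<) with + k ℤ.≤? excess p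
...   | yes k≤p = [] , p , [] , x , q , eq , inj₁ (k≤p , below-double x<)
...   | no k≰p  = p , x , [] , q , [] , eq′ , inj₂ (below-double x< , k≤q)
  where
  eq′ : ds ≡ p ++ x ++ [] ++ q ++ []
  eq′ = trans eq (cong (λ r → p ++ x ++ r) (sym (List.++-identityʳ q)))
  k≤q : + k ℤ.≤ excess q
  k≤q = excess-rest k (excess p) (excess x) (excess q)
          (subst (0ℤ ℤ.<_) (trans (cong excess eq) (excess-++-++ p x q)) positive)
          (ℤ.≰⇒> k≰p) x<

positive-cycle-stretches : ∀ k {v} (w : Walk (ShiftGraph ((k + k) + (k + k))) v v) →
                           0ℤ ℤ.< excess (dirs w) → TwoStretches k (dirs w)
positive-cycle-stretches k w positive =
  split-at-drop k (dirs w) positive (positive-cycle-drops (k + k) w positive)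

shiftGraph-unbalanced : ∀ k → Unbalanced k (ShiftGraph ((k + k) + (k + k)))
shiftGraph-unbalanced k (v , w) with ℤ.<-cmp 0ℤ (excess (dirs w))
... | tri≈ _ balanced _ = inj₁ (sym balanced)
... | tri< positive _ _ = inj₂ (positive-cycle-stretches k w positive)
... | tri> _ _ negative =
  inj₂ (TwoStretches-mirror (subst (TwoStretches k) (dirs-reverseWalk w) reversed))
  where
  reversed : TwoStretches k (dirs (reverseWalk w))
  reversed = positive-cycle-stretches k (reverseWalk w)
    (subst (0ℤ ℤ.<_) (sym (trans (cong excess (dirs-reverseWalk w)) (excess-mirror (dirs w))))
      (ℤ.neg-mono-< negative))

snoc : ℕ → (ℕ → ℕ) → ℕ → ℕ → ℕ
snoc s t y i with i ℕ.≤? s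
... | yes _ = t i
... | no _  = y

snoc-≤ : ∀ s t y {i} → i ≤ s → snoc s t y i ≡ t i
snoc-≤ s t y {i} i≤s with i ℕ.≤? s
... | yes _   = refl
... | no i≰s  = ⊥-elim (i≰s i≤s)

snoc-top : ∀ s t y → snoc s t y (suc s) ≡ y
snoc-top s t y with suc s ℕ.≤? s
... | yes s<s = ⊥-elim (ℕ.<-irrefl refl s<s)
... | no _    = refl

extend : ∀ {s} (a : Tuple s) y → at a s < y → Tuple (suc s)
extend {s} a y a<y = record { at = snoc s (at a) y ; increasing = increasing′ }
  where
  increasing′ : ∀ {i} → i < suc s → snoc s (at a) y i < snoc s (at a) y (suc i)
  increasing′ (s≤s i≤s) with ℕ.m≤n⇒m<n∨m≡n i≤s
  ... | inj₁ i<s  =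
    subst₂ _<_ (sym (snoc-≤ s (at a) y i≤s)) (sym (snoc-≤ s (at a) y i<s)) (increasing a i<s)
  ... | inj₂ refl = subst₂ _<_ (sym (snoc-≤ s (at a) y i≤s)) (sym (snoc-top s (at a) y)) a<y

extend-Shift : ∀ {s a b} (e : Shift s a b) y (b<y : at b s < y) →
               Shift (suc s) (extend a (at b s) (grows e)) (extend b y b<y)
extend-Shift {s} {a} {b} e y b<y = record { shifted = shifted′ ; grows = grows′ }
  where
  shifted′ : ∀ {i} → i < suc s → snoc s (at b) y i ≡ snoc s (at a) (at b s) (suc i)
  shifted′ (s≤s i≤s) with ℕ.m≤n⇒m<n∨m≡n i≤s
  ... | inj₁ i<s  =
    trans (snoc-≤ s (at b) y i≤s) (trans (shifted e i<s) (sym (snoc-≤ s (at a) (at b s) i<s)))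
  ... | inj₂ refl = trans (snoc-≤ s (at b) y i≤s) (sym (snoc-top s (at a) (at b s)))
  grows′ : snoc s (at a) (at b s) (suc s) < snoc s (at b) y (suc s)
  grows′ = subst₂ _<_ (sym (snoc-top s (at a) (at b s))) (sym (snoc-top s (at b) y)) b<y

constant : ℕ → Tuple 0
constant n = record { at = λ _ → n ; increasing = λ () }

ProperBelow : ∀ {s m} → ℕ → (Tuple s → Fin m) → Set
ProperBelow {s} N c = ∀ a b → at a s < N → at b s < N → Shift s a b → c a ≢ c b

indicator : ∀ {X : Set} → Dec X → Fin 2
indicator (yes _) = Fin.suc Fin.zero
indicator (no _)  = Fin.zero

indicator-separates : ∀ {X Y : Set} (x? : Dec X) (y? : Dec Y) →
                      X → ¬ Y → indicator x? ≢ indicator y?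
indicator-separates (yes _) (no _)  _ _  ()
indicator-separates (no ¬x) _       x _  _ = ¬x x
indicator-separates (yes _) (yes y) _ ¬y _ = ¬y y

-- colouring a is the set of colours c gives to the extensions of a by a new top entry below N;
-- the bound N is what makes this set computable.
module Induced {s m} (N : ℕ) (c : Tuple (suc s) → Fin m) where

  ExtendsWith : Tuple s → Fin m → ℕ → Set
  ExtendsWith a j y = Σ (at a s < y) λ a<y → c (extend a y a<y) ≡ j

  extendsWith? : ∀ a j y → Dec (ExtendsWith a j y)
  extendsWith? a j y with at a s ℕ.<? y
  ... | no a≮y = no (a≮y ∘ proj₁)
  ... | yes a<y with c (extend a y a<y) Fin.≟ j
  ...   | yes same = yes (a<y , same)
  ...   | no other = no λ (a<y′ , same) →
    other (subst (λ lt → c (extend a y lt) ≡ j) (ℕ.<-irrelevant a<y′ a<y) same)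

  extendsBelow? : ∀ a j → Dec (∃[ y ] y < N × ExtendsWith a j y)
  extendsBelow? a j = ℕ.anyUpTo? (extendsWith? a j) N

  colouring : Tuple s → Fin (2 ^ m)
  colouring a = funToFin λ j → indicator (extendsBelow? a j)

  colouring-proper : ProperBelow N c → ProperBelow N colouring
  colouring-proper proper a b a<N b<N e same =
    indicator-separates (extendsBelow? a j) (extendsBelow? b j)
      (at b s , b<N , grows e , refl) ¬extends-b sameIndicator
    where
    A : Tuple (suc s)
    A = extend a (at b s) (grows e)
    j : Fin m
    j = c A
    ¬extends-b : ¬ (∃[ y ] y < N × ExtendsWith b j y)
    ¬extends-b (y , y<N , b<y , cB≡j) =
      proper A (extend b y b<y) (subst (_< N) (sym (snoc-top s (at a) (at b s))) b<N)
        (subst (_< N) (sym (snoc-top s (at b) y)) y<N)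
        (extend-Shift e y b<y) (sym cB≡j)
    sameIndicator : indicator (extendsBelow? a j) ≡ indicator (extendsBelow? b j)
    sameIndicator = trans (sym (Fin.finToFun-funToFin _ j))
                      (trans (cong (λ z → finToFun z j) same) (Fin.finToFun-funToFin _ j))

shiftGraph-bounded-colouring : ∀ s m → ∃[ N ] ∀ (c : Tuple s → Fin m) → ¬ ProperBelow N c
shiftGraph-bounded-colouring zero m = suc m , pigeon
  where
  pigeon : ∀ (c : Tuple 0 → Fin m) → ¬ ProperBelow (suc m) c
  pigeon c proper with Fin.pigeonhole (ℕ.n<1+n m) (c ∘ constant ∘ toℕ)
  ... | i , j , i<j , same =
    proper (constant (toℕ i)) (constant (toℕ j)) (Fin.toℕ<n i) (Fin.toℕ<n j)
      (record { shifted = λ () ; grows = i<j }) same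
shiftGraph-bounded-colouring (suc s) m with shiftGraph-bounded-colouring s (2 ^ m)
... | N , none = N , λ c proper → none (Induced.colouring N c) (Induced.colouring-proper N c proper)

shiftGraph-not-colourable : ∀ s m → ¬ Colourable (ShiftGraph s) m
shiftGraph-not-colourable s m (c , proper) with shiftGraph-bounded-colouring s m
... | N , none = none c (λ a b _ _ → proper a b)

theorem8 : (k : ℕ) → 1 Data.Nat.≤ k → (m : ℕ) →
    Σ Digraph λ G → Unbalanced k G × ¬ Colourable G m
theorem8 k _ m = ShiftGraph s , shiftGraph-unbalanced k , shiftGraph-not-colourable s m
  where
  s : ℕ
  s = (k + k) + (k + k)
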